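{- Let $d,N\ge1$ be integers and let $U_1,\dots,U_N,V_1,\dots,V_N\in\{0,1\}^d$. Over the alphabet $\{0,1,a,b\}$ let $H=(a^d b)^{d+1}$, $X = H U_1 H U_2 H \cdots H U_N H$ and $Y = H V_1 H V_2 H \cdots H V_N H$. Let $\varepsilon>0$ and let $k \le d/(1+\varepsilon)$. If an algorithm for \textsf{LCS with Approximately $k$ Mismatches} outputs a substring $S_1$ of $X$ and a substring $S_2$ of $Y$ of (equal) length at least $2(d+1)^2+d$ with $d_H(S_1,S_2)\le(1+\varepsilon)k$, then there exist $i,j\in[1,N]$ such that $d_H(U_i,V_j)\le(1+\varepsilon)k$.
   Context: $d_H$ denotes Hamming distance between equal-length strings. The \textsf{LCS with Approximately $k$ Mismatches} problem asks, given strings $X,Y$, an integer $k$ and $\varepsilon>0$, to return a pair of equal-length substrings of $X$ and $Y$, respectively, at Hamming distance at most $(1+\varepsilon)k$, whose length is at least the maximal length of a pair of substrings of $X$ and $Y$ at Hamming distance at most $k$.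
   Formalization: The parameter ε ranges over the positive rationals. -}

module Defs where

open import Data.Nat using (ℕ; zero; suc; _+_; _*_)
open import Data.Bool using (Bool; true; false)
open import Data.Fin using (Fin)
open import Data.Vec using (Vec; toList)
open import Data.List using (List; []; _∷_; _++_; replicate; concatMap; allFin; map)
open import Data.Integer using (+_)
open import Data.Product using (∃₂)
open import Relation.Binary.PropositionalEquality using (_≡_)
open import Data.Rational using (ℚ; _/_; _+_; _*_; 1ℚ)

data Σ₄ : Set where
  𝟘 𝟙 a b : Σ₄

_==_ : Σ₄ → Σ₄ → Bool
𝟘 == 𝟘 = true
𝟙 == 𝟙 = true
a == a = true
b == b = true
_ == _ = false

-- Hamming distance: number of positions where the two strings differ
-- (only meaningful for strings of equal length, which is always assumed).
dH : List Σ₄ → List Σ₄ → ℕ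
dH (x ∷ xs) (y ∷ ys) with x == y
... | true  = dH xs ys
... | false = suc (dH xs ys)
dH _ _ = zero

-- Hamming distance on {0,1}^d vectors (as Bool vectors, false = 0, true = 1)
dHv : ∀ {d} → Vec Bool d → Vec Bool d → ℕ
dHv Data.Vec.[] Data.Vec.[] = zero
dHv (true Data.Vec.∷ u) (true Data.Vec.∷ v) = dHv u v
dHv (false Data.Vec.∷ u) (false Data.Vec.∷ v) = dHv u v
dHv (_ Data.Vec.∷ u) (_ Data.Vec.∷ v) = suc (dHv u v)

bit : Bool → Σ₄
bit false = 𝟘
bit true  = 𝟙

word : ∀ {d} → Vec Bool d → List Σ₄
word u = map bit (toList u)

H : ℕ → List Σ₄
H d = concatMap (λ _ → replicate d a ++ (b ∷ [])) (allFin (suc d))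

build : ∀ d {N} → (Fin N → Vec Bool d) → List Σ₄
build d {N} W = H d ++ concatMap (λ i → word (W i) ++ H d) (allFin N)

_IsSubstringOf_ : List Σ₄ → List Σ₄ → Set
S IsSubstringOf T = ∃₂ λ p s → T ≡ p ++ S ++ s

ℕ→ℚ : ℕ → ℚ
ℕ→ℚ n = + n / 1

-- Classify letters by kind: a, b, or a bit. Kind by kind, both gadget strings are periodic
-- with period L = |H| + d, a period being H followed by a word. Let S₁ and S₂ occur at offsets
-- p and q. As |S₁| ≥ |H| + L, S₁ contains a full copy of H. If p ≢ q (mod L), this copy faces
-- at least d + 1 letters of another kind in S₂: for a shift of at most d or at least |H| every
-- b of H faces an a or a bit, and for shifts in between a whole word plus one neighbouring
-- letter faces H. Then dH(S₁, S₂) > d ≥ (1 + ε)k, which is excluded. So p ≡ q (mod L), and a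
-- word Uᵢ inside S₁ lies exactly opposite a word Vⱼ inside S₂, whence dH(Uᵢ, Vⱼ) ≤ dH(S₁, S₂).
module Submission where

open import Defs
open import Data.Nat
  using (ℕ; zero; suc; _+_; _*_; _∸_; _≤_; _<_; _≥_; z≤n; s≤s; s≤s⁻¹; z<s; _≟_; _<?_; NonZero)
open import Data.Nat.Properties
open import Data.Nat.DivMod
  using (_/_; _%_; n%n≡0; m≡m%n+[m/n]*n; m%n<n; m%n≤n; m<n⇒m%n≡m; [m+n]%n≡m%n; [m+kn]%n≡m%n;
         m<n*o⇒m/o<n)
open import Data.Nat.Tactic.RingSolver using (solve-∀)
open import Data.Bool using (Bool; true; false; if_then_else_)
open import Data.Fin as Fin using (Fin; fromℕ<)
open import Data.Vec as Vec using (Vec)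
open import Data.List using (List; []; _∷_; _++_; length; replicate; concat; concatMap; tabulate; allFin)
open import Data.List.Properties using (length-++; length-replicate; map-tabulate; ++-assoc; ++-identityʳ)
open import Data.Product using (∃; ∃₂; _×_; _,_; proj₁; proj₂)
open import Data.Sum using (_⊎_; inj₁; inj₂)
open import Relation.Nullary using (Dec; yes; no; contradiction)
open import Relation.Binary.PropositionalEquality
open import Function using (id; _∘_)
import Data.Integer as ℤ
import Data.Integer.Properties as ℤ
open import Data.Rational using (ℚ; mkℚ; *≤*; 0ℚ; 1ℚ)
  renaming (_+_ to _+ℚ_; _*_ to _*ℚ_; _<_ to _<ℚ_; _≤_ to _≤ℚ_)
open import Data.Rational.Properties using (normalize-coprime) renaming (≤-trans to ≤ℚ-trans)
open import Data.Nat.Coprimality using (1-coprimeTo) renaming (sym to sym-coprime)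

-- Junk value a beyond the end of the list; every use below stays within bounds.
at : List Σ₄ → ℕ → Σ₄
at []       _       = a
at (x ∷ xs) zero    = x
at (x ∷ xs) (suc n) = at xs n

at-++ˡ : ∀ xs {ys n} → n < length xs → at (xs ++ ys) n ≡ at xs n
at-++ˡ (x ∷ xs) {n = zero}  _         = refl
at-++ˡ (x ∷ xs) {n = suc n} (s≤s n<l) = at-++ˡ xs n<l

at-++ʳ : ∀ xs {ys} n → at (xs ++ ys) (length xs + n) ≡ at ys n
at-++ʳ []       n = refl
at-++ʳ (x ∷ xs) n = at-++ʳ xs n

at-replicate : ∀ {m n} x → n < m → at (replicate m x) n ≡ x
at-replicate {suc m} {zero}  x _         = refl
at-replicate {suc m} {suc n} x (s≤s n<m) = at-replicate x n<m

at-substring : ∀ {T} P S R {j} → T ≡ P ++ S ++ R → j < length S → at S j ≡ at T (length P + j)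
at-substring P S R {j} refl j<S = sym (trans (at-++ʳ P j) (at-++ˡ S j<S))

length-substring : ∀ {T} (P S R : List Σ₄) → T ≡ P ++ S ++ R → length P + length S ≤ length T
length-substring P S R refl = begin
  length P + length S                ≤⟨ +-monoʳ-≤ (length P) (m≤m+n (length S) (length R)) ⟩
  length P + (length S + length R)   ≡⟨ cong (length P +_) (length-++ S) ⟨
  length P + length (S ++ R)         ≡⟨ length-++ P ⟨
  length (P ++ S ++ R)               ∎
  where open ≤-Reasoning

length-concat-tabulate : ∀ {N K} (f : Fin N → List Σ₄) → (∀ i → length (f i) ≡ K) →
  length (concat (tabulate f)) ≡ N * K
length-concat-tabulate {zero}  f |f| = refl
length-concat-tabulate {suc N} f |f| =
  trans (length-++ (f Fin.zero))
        (cong₂ _+_ (|f| _) (length-concat-tabulate (λ i → f (Fin.suc i)) (λ i → |f| (Fin.suc i))))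

at-concat-tabulate : ∀ {N K} (f : Fin N → List Σ₄) → (∀ i → length (f i) ≡ K) →
  ∀ {t r} (t<N : t < N) → r < K → at (concat (tabulate f)) (t * K + r) ≡ at (f (fromℕ< t<N)) r
at-concat-tabulate {suc N} f |f| {zero}  _         r<K = at-++ˡ (f Fin.zero) (subst (_ <_) (sym (|f| _)) r<K)
at-concat-tabulate {suc N} {K} f |f| {suc t} {r} (s≤s t<N) r<K = begin
  at (f Fin.zero ++ rest) (K + t * K + r)                   ≡⟨ cong (at (f Fin.zero ++ rest)) shift ⟩
  at (f Fin.zero ++ rest) (length (f Fin.zero) + (t * K + r)) ≡⟨ at-++ʳ (f Fin.zero) _ ⟩
  at rest (t * K + r)
    ≡⟨ at-concat-tabulate (λ i → f (Fin.suc i)) (λ i → |f| (Fin.suc i)) t<N r<K ⟩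
  at (f (Fin.suc (fromℕ< t<N))) r                           ∎
  where
  open ≡-Reasoning
  rest = concat (tabulate (λ i → f (Fin.suc i)))
  shift : K + t * K + r ≡ length (f Fin.zero) + (t * K + r)
  shift = trans (+-assoc K (t * K) r) (cong (_+ (t * K + r)) (sym (|f| _)))

++-concatMap-rotate : ∀ {A : Set} (w : List Σ₄) (v : A → List Σ₄) xs →
  w ++ concatMap (λ x → v x ++ w) xs ≡ concatMap (λ x → w ++ v x) xs ++ w
++-concatMap-rotate w v []       = ++-identityʳ w
++-concatMap-rotate w v (x ∷ xs) = begin
  w ++ (v x ++ w) ++ R           ≡⟨ cong (w ++_) (++-assoc (v x) w R) ⟩
  w ++ v x ++ w ++ R             ≡⟨ cong (λ z → w ++ v x ++ z) (++-concatMap-rotate w v xs) ⟩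
  w ++ v x ++ R′ ++ w            ≡⟨ ++-assoc w (v x) (R′ ++ w) ⟨
  (w ++ v x) ++ R′ ++ w          ≡⟨ ++-assoc (w ++ v x) R′ w ⟨
  ((w ++ v x) ++ R′) ++ w        ∎
  where
  open ≡-Reasoning
  R  = concatMap (λ x → v x ++ w) xs
  R′ = concatMap (λ x → w ++ v x) xs

∑ : ℕ → (ℕ → ℕ) → ℕ
∑ zero    f = 0
∑ (suc n) f = f 0 + ∑ n (λ i → f (suc i))

∑-+ : ∀ m n f → ∑ (m + n) f ≡ ∑ m f + ∑ n (λ i → f (m + i))
∑-+ zero    n f = refl
∑-+ (suc m) n f = trans (cong (f 0 +_) (∑-+ m n (λ i → f (suc i)))) (sym (+-assoc (f 0) _ _))

∑-mono : ∀ n {f g} → (∀ i → i < n → f i ≤ g i) → ∑ n f ≤ ∑ n g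
∑-mono zero    f≤g = z≤n
∑-mono (suc n) f≤g = +-mono-≤ (f≤g 0 (s≤s z≤n)) (∑-mono n (λ i i<n → f≤g (suc i) (s≤s i<n)))

∑-ones : ∀ n → ∑ n (λ _ → 1) ≡ n
∑-ones zero    = refl
∑-ones (suc n) = cong suc (∑-ones n)

∑-point : ∀ {n i} f → i < n → f i ≤ ∑ n f
∑-point {suc n} {zero}  f _         = m≤m+n (f 0) _
∑-point {suc n} {suc i} f (s≤s i<n) = ≤-trans (∑-point (λ j → f (suc j)) i<n) (m≤n+m _ (f 0))

∑-window : ∀ o k {n} f → o + k ≤ n → ∑ k (λ i → f (o + i)) ≤ ∑ n f
∑-window o k {n} f o+k≤n = begin
  ∑ k (λ i → f (o + i))                                ≤⟨ m≤n+m _ (∑ o f) ⟩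
  ∑ o f + ∑ k (λ i → f (o + i))                        ≡⟨ ∑-+ o k f ⟨
  ∑ (o + k) f                                          ≤⟨ m≤m+n _ _ ⟩
  ∑ (o + k) f + ∑ (n ∸ (o + k)) (λ i → f (o + k + i))  ≡⟨ ∑-+ (o + k) (n ∸ (o + k)) f ⟨
  ∑ (o + k + (n ∸ (o + k))) f                          ≡⟨ cong (λ m → ∑ m f) (m+[n∸m]≡n o+k≤n) ⟩
  ∑ n f                                                ∎
  where open ≤-Reasoning

∑-interval : ∀ o k {n} f → o + k ≤ n → (∀ j → j < k → 1 ≤ f (o + j)) → k ≤ ∑ n f
∑-interval o k {n} f o+k≤n pos = begin
  k                     ≡⟨ ∑-ones k ⟨
  ∑ k (λ _ → 1)         ≤⟨ ∑-mono k pos ⟩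
  ∑ k (λ j → f (o + j)) ≤⟨ ∑-window o k f o+k≤n ⟩
  ∑ n f                 ∎
  where open ≤-Reasoning

∑-stride : ∀ M {K r} f → r < K → (∀ m → m < M → 1 ≤ f (m * K + r)) → M ≤ ∑ (M * K) f
∑-stride zero    f r<K pos = z≤n
∑-stride (suc M) {K} {r} f r<K pos = begin
  suc M                                  ≤⟨ +-mono-≤ (≤-trans (pos 0 (s≤s z≤n)) (∑-point f r<K)) ih ⟩
  ∑ K f + ∑ (M * K) (λ i → f (K + i))    ≡⟨ ∑-+ K (M * K) f ⟨
  ∑ (suc M * K) f                        ∎
  where
  open ≤-Reasoning
  ih : M ≤ ∑ (M * K) (λ i → f (K + i))
  ih = ∑-stride M (λ i → f (K + i)) r<K
         (λ m m<M → subst (λ i → 1 ≤ f i) (+-assoc K (m * K) r) (pos (suc m) (s≤s m<M)))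

mismatch : Σ₄ → Σ₄ → ℕ
mismatch x y = if x == y then 0 else 1

dH-∷ : ∀ x y xs ys → dH (x ∷ xs) (y ∷ ys) ≡ mismatch x y + dH xs ys
dH-∷ x y xs ys with x == y
... | true  = refl
... | false = refl

dH≡∑ : ∀ xs ys → length xs ≡ length ys →
  dH xs ys ≡ ∑ (length xs) (λ i → mismatch (at xs i) (at ys i))
dH≡∑ []       []       _   = refl
dH≡∑ (x ∷ xs) (y ∷ ys) |≡| =
  trans (dH-∷ x y xs ys) (cong (mismatch x y +_) (dH≡∑ xs ys (suc-injective |≡|)))

dHv≡∑ : ∀ {d} (u v : Vec Bool d) → dHv u v ≡ ∑ d (λ e → mismatch (at (word u) e) (at (word v) e))
dHv≡∑ Vec.[]           Vec.[]           = refl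
dHv≡∑ (true  Vec.∷ u) (true  Vec.∷ v) = dHv≡∑ u v
dHv≡∑ (true  Vec.∷ u) (false Vec.∷ v) = cong suc (dHv≡∑ u v)
dHv≡∑ (false Vec.∷ u) (true  Vec.∷ v) = cong suc (dHv≡∑ u v)
dHv≡∑ (false Vec.∷ u) (false Vec.∷ v) = dHv≡∑ u v

≢⇒mismatch≡1 : ∀ {x y} → x ≢ y → mismatch x y ≡ 1
≢⇒mismatch≡1 {𝟘} {𝟘} x≢y = contradiction refl x≢y
≢⇒mismatch≡1 {𝟙} {𝟙} x≢y = contradiction refl x≢y
≢⇒mismatch≡1 {a} {a} x≢y = contradiction refl x≢y
≢⇒mismatch≡1 {b} {b} x≢y = contradiction refl x≢y
≢⇒mismatch≡1 {𝟘} {𝟙} _ = refl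
≢⇒mismatch≡1 {𝟘} {a} _ = refl
≢⇒mismatch≡1 {𝟘} {b} _ = refl
≢⇒mismatch≡1 {𝟙} {𝟘} _ = refl
≢⇒mismatch≡1 {𝟙} {a} _ = refl
≢⇒mismatch≡1 {𝟙} {b} _ = refl
≢⇒mismatch≡1 {a} {𝟘} _ = refl
≢⇒mismatch≡1 {a} {𝟙} _ = refl
≢⇒mismatch≡1 {a} {b} _ = refl
≢⇒mismatch≡1 {b} {𝟘} _ = refl
≢⇒mismatch≡1 {b} {𝟙} _ = refl
≢⇒mismatch≡1 {b} {a} _ = refl

t*K+r<N*K : ∀ {t r N K} → t < N → r < K → t * K + r < N * K
t*K+r<N*K {t} {r} {N} {K} t<N r<K = begin-strict
  t * K + r   <⟨ +-monoʳ-< (t * K) r<K ⟩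
  t * K + K   ≡⟨ +-comm (t * K) K ⟩
  suc t * K   ≤⟨ *-monoˡ-≤ K t<N ⟩
  N * K       ∎
  where open ≤-Reasoning

[m%n+k]%n≡[m+k]%n : ∀ m k n .{{_ : NonZero n}} → (m % n + k) % n ≡ (m + k) % n
[m%n+k]%n≡[m+k]%n m k n = begin
  (m % n + k) % n                ≡⟨ [m+kn]%n≡m%n (m % n + k) (m / n) n ⟨
  (m % n + k + m / n * n) % n    ≡⟨ cong (_% n) (reorder (m % n) k (m / n * n)) ⟩
  (m % n + m / n * n + k) % n    ≡⟨ cong (λ x → (x + k) % n) (m≡m%n+[m/n]*n m n) ⟨
  (m + k) % n                    ∎
  where
  open ≡-Reasoning
  reorder : ∀ x y z → x + y + z ≡ x + z + y
  reorder = solve-∀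

[m+k]%n≡[o+k]%n⇒[m+j]%n≡[o+j]%n : ∀ m o k j {n} .{{_ : NonZero n}} →
  (m + k) % n ≡ (o + k) % n → (m + j) % n ≡ (o + j) % n
[m+k]%n≡[o+k]%n⇒[m+j]%n≡[o+j]%n m o k j {n@(suc n′)} eq = begin
  (m + j) % n                   ≡⟨ translate m ⟩
  ((m + k) % n + c) % n         ≡⟨ cong (λ x → (x + c) % n) eq ⟩
  ((o + k) % n + c) % n         ≡⟨ translate o ⟨
  (o + j) % n                   ∎
  where
  open ≡-Reasoning
  c = j + k * n′
  rearrange : ∀ x j k n′ → x + j + k * suc n′ ≡ x + k + (j + k * n′)
  rearrange = solve-∀
  -- adding k * n changes nothing mod n, and k * n = k + k * n′
  translate : ∀ x → (x + j) % n ≡ ((x + k) % n + c) % n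
  translate x = begin
    (x + j) % n               ≡⟨ [m+kn]%n≡m%n (x + j) k n ⟨
    (x + j + k * n) % n       ≡⟨ cong (_% n) (rearrange x j k n′) ⟩
    (x + k + c) % n           ≡⟨ [m%n+k]%n≡[m+k]%n (x + k) c n ⟨
    ((x + k) % n + c) % n     ∎

∃-offset-with-residue : ∀ m {r n} .{{_ : NonZero n}} → r < n → ∃ λ j → j < n × (m + j) % n ≡ r
∃-offset-with-residue m {r} {n} r<n = x % n , m%n<n x n , (begin
  (m + x % n) % n         ≡⟨ cong (_% n) (+-comm m (x % n)) ⟩
  (x % n + m) % n         ≡⟨ [m%n+k]%n≡[m+k]%n x m n ⟩
  (x + m) % n             ≡⟨ cong (_% n) (+-comm x m) ⟩
  (m + x) % n             ≡⟨ [m%n+k]%n≡[m+k]%n m x n ⟨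
  (m % n + x) % n         ≡⟨ cong (_% n) (complete (m % n) (m%n≤n m n)) ⟩
  (r + n) % n             ≡⟨ [m+n]%n≡m%n r n ⟩
  r % n                   ≡⟨ m<n⇒m%n≡m r<n ⟩
  r                       ∎)
  where
  open ≡-Reasoning
  x = r + (n ∸ m % n)
  complete : ∀ y → y ≤ n → y + (r + (n ∸ y)) ≡ r + n
  complete y y≤n = trans (+-comm y _) (trans (+-assoc r _ y) (cong (r +_) (m∸n+n≡m y≤n)))

ℕ→ℚ≡mkℚ : ∀ n → ℕ→ℚ n ≡ mkℚ (ℤ.+ n) 0 (sym-coprime (1-coprimeTo n))
ℕ→ℚ≡mkℚ n = normalize-coprime (sym-coprime (1-coprimeTo n))

ℕ→ℚ-mono-≤ : ∀ {m n} → m ≤ n → ℕ→ℚ m ≤ℚ ℕ→ℚ n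
ℕ→ℚ-mono-≤ {m} {n} m≤n rewrite ℕ→ℚ≡mkℚ m | ℕ→ℚ≡mkℚ n =
  *≤* (subst₂ ℤ._≤_ (sym (ℤ.*-identityʳ (ℤ.+ m))) (sym (ℤ.*-identityʳ (ℤ.+ n))) (ℤ.+≤+ m≤n))

ℕ→ℚ-cancel-≤ : ∀ {m n} → ℕ→ℚ m ≤ℚ ℕ→ℚ n → m ≤ n
ℕ→ℚ-cancel-≤ {m} {n} m≤n rewrite ℕ→ℚ≡mkℚ m | ℕ→ℚ≡mkℚ n with m≤n
... | *≤* m*1≤n*1 with subst₂ ℤ._≤_ (ℤ.*-identityʳ (ℤ.+ m)) (ℤ.*-identityʳ (ℤ.+ n)) m*1≤n*1
... | ℤ.+≤+ m≤n′ = m≤n′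

length-word : ∀ {d} (u : Vec Bool d) → length (word u) ≡ d
length-word Vec.[]       = refl
length-word (x Vec.∷ u) = cong suc (length-word u)

data Kind : Set where
  kind-a kind-b kind-bit : Kind

kind : Σ₄ → Kind
kind 𝟘 = kind-bit
kind 𝟙 = kind-bit
kind a = kind-a
kind b = kind-b

is-b? : ∀ k → Dec (k ≡ kind-b)
is-b? kind-a   = no λ ()
is-b? kind-b   = yes refl
is-b? kind-bit = no λ ()

kind-word : ∀ {d} (u : Vec Bool d) {e} → e < d → kind (at (word u) e) ≡ kind-bit
kind-word (true  Vec.∷ u) {zero}  _         = refl
kind-word (false Vec.∷ u) {zero}  _         = refl
kind-word (x     Vec.∷ u) {suc e} (s≤s e<d) = kind-word u e<d

-- h = |H| and L = |H w| for a word w of length d.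
module Gadget (d : ℕ) (1≤d : 1 ≤ d) where

  D h L : ℕ
  D = suc d
  h = D * D
  L = h + d

  aᵈb : List Σ₄
  aᵈb = replicate d a ++ b ∷ []

  blockKind : ℕ → Kind
  blockKind e with e ≟ d
  ... | yes _ = kind-b
  ... | no  _ = kind-a

  -- The kind of letter r of H w for any word w of length d (r < L).
  periodKind : ℕ → Kind
  periodKind r with r <? h
  ... | yes _ = blockKind (r % D)
  ... | no  _ = kind-bit

  blockKind-d : blockKind d ≡ kind-b
  blockKind-d with d ≟ d
  ... | yes _   = refl
  ... | no  d≢d = contradiction refl d≢d

  blockKind-< : ∀ {e} → e < d → blockKind e ≡ kind-a
  blockKind-< {e} e<d with e ≟ d
  ... | yes e≡d = contradiction e≡d (<⇒≢ e<d)
  ... | no  _   = refl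

  blockKind≢bit : ∀ e → blockKind e ≢ kind-bit
  blockKind≢bit e with e ≟ d
  ... | yes _ = λ ()
  ... | no  _ = λ ()

  periodKind-< : ∀ {r} → r < h → periodKind r ≡ blockKind (r % D)
  periodKind-< {r} r<h with r <? h
  ... | yes _   = refl
  ... | no  r≮h = contradiction r<h r≮h

  periodKind-≥ : ∀ {r} → h ≤ r → periodKind r ≡ kind-bit
  periodKind-≥ {r} h≤r with r <? h
  ... | yes r<h = contradiction h≤r (<⇒≱ r<h)
  ... | no  _   = refl

  [m*D+e]%D≡e : ∀ m {e} → e < D → (m * D + e) % D ≡ e
  [m*D+e]%D≡e m {e} e<D = trans (cong (_% D) (+-comm (m * D) e)) (trans ([m+kn]%n≡m%n e m D) (m<n⇒m%n≡m e<D))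

  periodKind-b : ∀ {m} → m < D → periodKind (m * D + d) ≡ kind-b
  periodKind-b {m} m<D = begin
    periodKind (m * D + d)      ≡⟨ periodKind-< (t*K+r<N*K {N = D} {K = D} m<D ≤-refl) ⟩
    blockKind ((m * D + d) % D) ≡⟨ cong blockKind ([m*D+e]%D≡e m ≤-refl) ⟩
    blockKind d                 ≡⟨ blockKind-d ⟩
    kind-b                      ∎
    where open ≡-Reasoning

  periodKind-a : ∀ m {e} → m * D + e < h → e < d → periodKind (m * D + e) ≡ kind-a
  periodKind-a m {e} r<h e<d = begin
    periodKind (m * D + e)      ≡⟨ periodKind-< r<h ⟩
    blockKind ((m * D + e) % D) ≡⟨ cong blockKind ([m*D+e]%D≡e m (m≤n⇒m≤1+n e<d)) ⟩
    blockKind e                 ≡⟨ blockKind-< e<d ⟩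
    kind-a                      ∎
    where open ≡-Reasoning

  periodKind-bit : ∀ {e} → periodKind (h + e) ≡ kind-bit
  periodKind-bit {e} = periodKind-≥ (m≤m+n h e)

  periodKind≢bit : ∀ {r} → r < h → periodKind r ≢ kind-bit
  periodKind≢bit {r} r<h = subst (_≢ kind-bit) (sym (periodKind-< r<h)) (blockKind≢bit (r % D))

  periodKind≢b : ∀ m {e} → e < d → periodKind (m * D + e) ≢ kind-b
  periodKind≢b m {e} e<d with <-≤-connex (m * D + e) h
  ... | inj₁ r<h = λ eq → contradiction (trans (sym (periodKind-a m r<h e<d)) eq) λ ()
  ... | inj₂ h≤r = λ eq → contradiction (trans (sym (periodKind-≥ h≤r)) eq) λ ()

  periodKind-+D : ∀ {r} → r + D < h → periodKind (r + D) ≡ periodKind r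
  periodKind-+D {r} r+D<h = begin
    periodKind (r + D)        ≡⟨ periodKind-< r+D<h ⟩
    blockKind ((r + D) % D)   ≡⟨ cong blockKind ([m+n]%n≡m%n r D) ⟩
    blockKind (r % D)         ≡⟨ periodKind-< (<-trans (m<m+n r z<s) r+D<h) ⟨
    periodKind r              ∎
    where open ≡-Reasoning

  module _ {s : ℕ} (f g : ℕ → Σ₄)
           (kind-f : ∀ {i} → i < h → kind (f i) ≡ periodKind i)
           (kind-g : ∀ {i} → i < h → kind (g i) ≡ periodKind ((s + i) % L)) where

    private
      δ : ℕ → ℕ
      δ i = mismatch (f i) (g i)

      mismatch-at : ∀ {i} → i < h → periodKind i ≢ periodKind ((s + i) % L) → 1 ≤ δ i
      mismatch-at {i} i<h kinds≢ = ≤-reflexive (sym (≢⇒mismatch≡1 λ fi≡gi →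
        kinds≢ (trans (sym (kind-f i<h)) (trans (cong kind fi≡gi) (kind-g i<h)))))

      mismatch-at-b : ∀ {m} → m < D → ∀ m′ {e′} → e′ < d → (s + (m * D + d)) % L ≡ m′ * D + e′ →
        1 ≤ δ (m * D + d)
      mismatch-at-b m<D m′ e′<d shifted = mismatch-at (t*K+r<N*K {N = D} {K = D} m<D ≤-refl) λ kinds≡ →
        periodKind≢b m′ e′<d (trans (cong periodKind (sym shifted)) (trans (sym kinds≡) (periodKind-b m<D)))

      -- The hypothesis puts the letter of g opposite each b of f at an a or a bit.
      b-slots-mismatch : (∀ {m} → m < D → ∃₂ λ m′ e′ → e′ < d × (s + (m * D + d)) % L ≡ m′ * D + e′) →
        D ≤ ∑ h δ
      b-slots-mismatch lands = ∑-stride D δ ≤-refl λ m m<D →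
        let m′ , e′ , e′<d , shifted = lands m<D in mismatch-at-b m<D m′ e′<d shifted

    -- With i₀ = h - 1 - s, g reads a word on the d positions after i₀ while f reads H. One more
    -- mismatch is at i₀, where g reads the last b of H, unless f reads a b there as well; then f
    -- reads a b again D positions later, where g reads the first a of the next H.
    module _ (d<s : d < s) (s<h : s < h) where
      private
        i₀ = proj₁ (m≤n⇒∃[o]m+o≡n s<h)

        1+s+i₀≡h : suc s + i₀ ≡ h
        1+s+i₀≡h = proj₂ (m≤n⇒∃[o]m+o≡n s<h)

        shift-by-i₀ : ∀ e → s + (suc i₀ + e) ≡ h + e
        shift-by-i₀ e = trans (rearrange s i₀ e) (cong (_+ e) 1+s+i₀≡h)
          where
          rearrange : ∀ s i e → s + (suc i + e) ≡ suc s + i + e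
          rearrange = solve-∀

        i₀+e<h : ∀ {e} → e ≤ s → i₀ + e < h
        i₀+e<h {e} e≤s = begin-strict
          i₀ + e   ≤⟨ +-monoʳ-≤ i₀ e≤s ⟩
          i₀ + s   ≡⟨ +-comm i₀ s ⟩
          s + i₀   <⟨ ≤-reflexive 1+s+i₀≡h ⟩
          h        ∎
          where open ≤-Reasoning

        word-slot : ∀ {e} → e < d → 1 ≤ δ (suc i₀ + e)
        word-slot {e} e<d = mismatch-at in-H λ kinds≡ → periodKind≢bit in-H (begin
          periodKind (suc i₀ + e)              ≡⟨ kinds≡ ⟩
          periodKind ((s + (suc i₀ + e)) % L)  ≡⟨ cong (λ x → periodKind (x % L)) (shift-by-i₀ e) ⟩
          periodKind ((h + e) % L)             ≡⟨ cong periodKind (m<n⇒m%n≡m (+-monoʳ-< h e<d)) ⟩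
          periodKind (h + e)                   ≡⟨ periodKind-bit ⟩
          kind-bit                             ∎)
          where
          open ≡-Reasoning
          in-H : suc i₀ + e < h
          in-H = subst (_< h) (+-suc i₀ e) (i₀+e<h (<-trans e<d d<s))

        last-b-slot : periodKind i₀ ≢ kind-b → 1 ≤ δ i₀
        last-b-slot i₀≢b = mismatch-at i₀<h λ kinds≡ → i₀≢b (begin
          periodKind i₀              ≡⟨ kinds≡ ⟩
          periodKind ((s + i₀) % L)  ≡⟨ cong (λ x → periodKind (x % L)) s+i₀≡last-b ⟩
          periodKind ((d * D + d) % L) ≡⟨ cong periodKind (m<n⇒m%n≡m last-b<L) ⟩
          periodKind (d * D + d)     ≡⟨ periodKind-b ≤-refl ⟩
          kind-b                     ∎)
          where
          open ≡-Reasoning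
          i₀<h : i₀ < h
          i₀<h = subst (i₀ <_) 1+s+i₀≡h (s≤s (m≤n+m i₀ s))
          s+i₀≡last-b : s + i₀ ≡ d * D + d
          s+i₀≡last-b = trans (suc-injective 1+s+i₀≡h) (+-comm d (d * D))
          last-b<L : d * D + d < L
          last-b<L = <-≤-trans (t*K+r<N*K {N = D} {K = D} ≤-refl ≤-refl) (m≤m+n h d)

        first-a-slot : periodKind i₀ ≡ kind-b → 1 ≤ δ (suc i₀ + d)
        first-a-slot i₀≡b = mismatch-at in-H λ kinds≡ → b≢a (begin
          kind-b                              ≡⟨ i₀≡b ⟨
          periodKind i₀                       ≡⟨ periodKind-+D in-H′ ⟨
          periodKind (i₀ + D)                 ≡⟨ cong periodKind (+-suc i₀ d) ⟩
          periodKind (suc i₀ + d)             ≡⟨ kinds≡ ⟩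
          periodKind ((s + (suc i₀ + d)) % L) ≡⟨ cong (λ x → periodKind (x % L)) (shift-by-i₀ d) ⟩
          periodKind (L % L)                  ≡⟨ cong periodKind (n%n≡0 L) ⟩
          periodKind 0                        ≡⟨ periodKind-a 0 (t*K+r<N*K {N = D} {K = D} z<s z<s) 1≤d ⟩
          kind-a                              ∎)
          where
          open ≡-Reasoning
          b≢a : kind-b ≢ kind-a
          b≢a ()
          in-H′ : i₀ + D < h
          in-H′ = i₀+e<h d<s
          in-H : suc i₀ + d < h
          in-H = subst (_< h) (+-suc i₀ d) in-H′

      overlap-mismatch : D ≤ ∑ h δ
      overlap-mismatch with is-b? (periodKind i₀)
      ... | no  i₀≢b = ∑-interval i₀ D δ (<⇒≤ (i₀+e<h d<s)) λ where
        zero    _         → subst (λ i → 1 ≤ δ i) (sym (+-identityʳ i₀)) (last-b-slot i₀≢b)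
        (suc e) (s≤s e<d) → subst (λ i → 1 ≤ δ i) (sym (+-suc i₀ e)) (word-slot e<d)
      ... | yes i₀≡b = ∑-interval (suc i₀) D δ (i₀+e<h d<s) λ j j<D →
                         case-slot j (m≤n⇒m<n∨m≡n (s≤s⁻¹ j<D))
        where
        case-slot : ∀ j → j < d ⊎ j ≡ d → 1 ≤ δ (suc i₀ + j)
        case-slot j (inj₁ j<d)  = word-slot j<d
        case-slot _ (inj₂ refl) = first-a-slot i₀≡b

    private
      small-shift-mismatch : 1 ≤ s → s ≤ d → D ≤ ∑ h δ
      small-shift-mismatch 1≤s s≤d with m≤n⇒∃[o]m+o≡n 1≤s
      ... | s′ , 1+s′≡s = b-slots-mismatch λ {m} m<D → suc m , s′ , s′<d , into-next-block m<D
        where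
        s′<d : s′ < d
        s′<d = subst (_≤ d) (sym 1+s′≡s) s≤d
        into-next-block : ∀ {m} → m < D → (s + (m * D + d)) % L ≡ suc m * D + s′
        into-next-block {m} m<D = begin
          (s + (m * D + d)) % L      ≡⟨ cong (λ x → (x + (m * D + d)) % L) 1+s′≡s ⟨
          (suc s′ + (m * D + d)) % L ≡⟨ cong (_% L) (rearrange s′ m d) ⟩
          (suc m * D + s′) % L       ≡⟨ m<n⇒m%n≡m (+-mono-≤-< (*-monoˡ-≤ D m<D) s′<d) ⟩
          suc m * D + s′             ∎
          where
          open ≡-Reasoning
          rearrange : ∀ s′ m d → suc s′ + (m * suc d + d) ≡ suc m * suc d + s′
          rearrange = solve-∀

      large-shift-mismatch : h ≤ s → s < L → D ≤ ∑ h δ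
      large-shift-mismatch h≤s s<L with m≤n⇒∃[o]m+o≡n h≤s
      ... | e , h+e≡s = b-slots-mismatch λ {m} m<D → m , e , e<d , into-next-period m<D
        where
        e<d : e < d
        e<d = +-cancelˡ-< h e d (subst (_< L) (sym h+e≡s) s<L)
        into-next-period : ∀ {m} → m < D → (s + (m * D + d)) % L ≡ m * D + e
        into-next-period {m} m<D = begin
          (s + (m * D + d)) % L         ≡⟨ cong (λ x → (x + (m * D + d)) % L) h+e≡s ⟨
          (h + e + (m * D + d)) % L     ≡⟨ cong (_% L) (rearrange e m d) ⟩
          (m * D + e + L) % L           ≡⟨ [m+n]%n≡m%n (m * D + e) L ⟩
          (m * D + e) % L               ≡⟨ m<n⇒m%n≡m (<-≤-trans m*D+e<h (m≤m+n h d)) ⟩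
          m * D + e                     ∎
          where
          open ≡-Reasoning
          m*D+e<h : m * D + e < h
          m*D+e<h = t*K+r<N*K {N = D} {K = D} m<D (m≤n⇒m≤1+n e<d)
          rearrange : ∀ e m d → suc d * suc d + e + (m * suc d + d) ≡ m * suc d + e + (suc d * suc d + d)
          rearrange = solve-∀

    shifted-period-mismatches : 1 ≤ s → s < L → D ≤ ∑ h (λ i → mismatch (f i) (g i))
    shifted-period-mismatches 1≤s s<L with s ≤? d | s <? h
    ... | yes s≤d | _       = small-shift-mismatch 1≤s s≤d
    ... | no  s≰d | yes s<h = overlap-mismatch (≰⇒> s≰d) s<h
    ... | no  _   | no  s≮h = large-shift-mismatch (≮⇒≥ s≮h) s<L

  length-aᵈb : length aᵈb ≡ D
  length-aᵈb = trans (length-++ (replicate d a)) (trans (cong (_+ 1) (length-replicate d)) (+-comm d 1))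

  kind-aᵈb : ∀ {e} → e < D → kind (at aᵈb e) ≡ blockKind e
  kind-aᵈb {e} e<D with m≤n⇒m<n∨m≡n (s≤s⁻¹ e<D)
  ... | inj₁ e<d  = begin
    kind (at aᵈb e)             ≡⟨ cong kind (at-++ˡ (replicate d a) (subst (e <_) (sym (length-replicate d)) e<d)) ⟩
    kind (at (replicate d a) e) ≡⟨ cong kind (at-replicate a e<d) ⟩
    kind-a                      ≡⟨ blockKind-< e<d ⟨
    blockKind e                 ∎
    where open ≡-Reasoning
  ... | inj₂ refl = begin
    kind (at aᵈb d)                                    ≡⟨ cong (kind ∘ at aᵈb) d≡ ⟩
    kind (at aᵈb (length (replicate d a) + 0))         ≡⟨ cong kind (at-++ʳ (replicate d a) 0) ⟩
    kind-b                                             ≡⟨ blockKind-d ⟨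
    blockKind d                                        ∎
    where
    open ≡-Reasoning
    d≡ : d ≡ length (replicate d a) + 0
    d≡ = trans (sym (+-identityʳ d)) (cong (_+ 0) (sym (length-replicate d)))

  H≡concat-aᵈb : H d ≡ concat (tabulate {n = D} (λ _ → aᵈb))
  H≡concat-aᵈb = cong concat (map-tabulate {n = D} id (λ _ → aᵈb))

  length-H : length (H d) ≡ h
  length-H = trans (cong length H≡concat-aᵈb)
                   (length-concat-tabulate {D} (λ _ → aᵈb) (λ _ → length-aᵈb))

  kind-H : ∀ {r} → r < h → kind (at (H d) r) ≡ periodKind r
  kind-H {r} r<h = begin
    kind (at (H d) r)
      ≡⟨ cong (kind ∘ at (H d)) (trans (m≡m%n+[m/n]*n r D) (+-comm (r % D) _)) ⟩
    kind (at (H d) (r / D * D + r % D))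
      ≡⟨ cong (λ w → kind (at w (r / D * D + r % D))) H≡concat-aᵈb ⟩
    kind (at (concat (tabulate {n = D} (λ _ → aᵈb))) (r / D * D + r % D))
      ≡⟨ cong kind (at-concat-tabulate {D} (λ _ → aᵈb) (λ _ → length-aᵈb) (m<n*o⇒m/o<n r<h) (m%n<n r D)) ⟩
    kind (at aᵈb (r % D))
      ≡⟨ kind-aᵈb (m%n<n r D) ⟩
    blockKind (r % D)
      ≡⟨ periodKind-< r<h ⟨
    periodKind r
      ∎
    where open ≡-Reasoning

  length-block : (u : Vec Bool d) → length (H d ++ word u) ≡ L
  length-block u = trans (length-++ (H d)) (cong₂ _+_ length-H (length-word u))

  kind-block : (u : Vec Bool d) → ∀ {r} → r < L → kind (at (H d ++ word u) r) ≡ periodKind r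
  kind-block u {r} r<L with <-≤-connex r h
  ... | inj₁ r<h = trans (cong kind (at-++ˡ (H d) (subst (r <_) (sym length-H) r<h))) (kind-H r<h)
  ... | inj₂ h≤r = begin
    kind (at (H d ++ word u) r)                         ≡⟨ cong (kind ∘ at (H d ++ word u)) r≡ ⟩
    kind (at (H d ++ word u) (length (H d) + (r ∸ h)))  ≡⟨ cong kind (at-++ʳ (H d) (r ∸ h)) ⟩
    kind (at (word u) (r ∸ h))                          ≡⟨ kind-word u r∸h<d ⟩
    kind-bit                                            ≡⟨ periodKind-≥ h≤r ⟨
    periodKind r                                        ∎
    where
    open ≡-Reasoning
    r≡ : r ≡ length (H d) + (r ∸ h)
    r≡ = trans (sym (m+[n∸m]≡n h≤r)) (cong (_+ (r ∸ h)) (sym length-H))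
    r∸h<d : r ∸ h < d
    r∸h<d = +-cancelˡ-< h (r ∸ h) d (subst (_< L) (sym (m+[n∸m]≡n h≤r)) r<L)

  module _ {N : ℕ} (W : Fin N → Vec Bool d) where

    blocks : List Σ₄
    blocks = concat (tabulate (λ i → H d ++ word (W i)))

    build≡blocks++H : build d W ≡ blocks ++ H d
    build≡blocks++H = trans (++-concatMap-rotate (H d) (λ i → word (W i)) (allFin N))
                            (cong (λ xs → concat xs ++ H d) (map-tabulate id (λ i → H d ++ word (W i))))

    length-blocks : length blocks ≡ N * L
    length-blocks = length-concat-tabulate _ (λ i → length-block (W i))

    length-build : length (build d W) ≡ N * L + h
    length-build = trans (cong length build≡blocks++H)
                         (trans (length-++ blocks) (cong₂ _+_ length-blocks length-H))

    kind-build : ∀ {n} → n < length (build d W) → kind (at (build d W) n) ≡ periodKind (n % L)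
    kind-build {n} n<|X| with <-≤-connex n (N * L)
    ... | inj₁ n<NL = begin
      kind (at (build d W) n)
        ≡⟨ cong (λ X → kind (at X n)) build≡blocks++H ⟩
      kind (at (blocks ++ H d) n)
        ≡⟨ cong kind (at-++ˡ blocks (subst (n <_) (sym length-blocks) n<NL)) ⟩
      kind (at blocks n)
        ≡⟨ cong (kind ∘ at blocks) (trans (m≡m%n+[m/n]*n n L) (+-comm (n % L) _)) ⟩
      kind (at blocks (n / L * L + n % L))
        ≡⟨ cong kind (at-concat-tabulate _ (λ i → length-block (W i)) (m<n*o⇒m/o<n n<NL) (m%n<n n L)) ⟩
      kind (at (H d ++ word _) (n % L))
        ≡⟨ kind-block _ (m%n<n n L) ⟩
      periodKind (n % L)
        ∎
      where open ≡-Reasoning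
    ... | inj₂ NL≤n = begin
      kind (at (build d W) n)                   ≡⟨ cong (λ X → kind (at X n)) build≡blocks++H ⟩
      kind (at (blocks ++ H d) n)               ≡⟨ cong (kind ∘ at (blocks ++ H d)) n≡ ⟩
      kind (at (blocks ++ H d) (length blocks + r)) ≡⟨ cong kind (at-++ʳ blocks r) ⟩
      kind (at (H d) r)                         ≡⟨ kind-H r<h ⟩
      periodKind r                              ≡⟨ cong periodKind r≡n%L ⟩
      periodKind (n % L)                        ∎
      where
      open ≡-Reasoning
      r = n ∸ N * L
      n≡ : n ≡ length blocks + r
      n≡ = trans (sym (m+[n∸m]≡n NL≤n)) (cong (_+ r) (sym length-blocks))
      r<h : r < h
      r<h = +-cancelˡ-< (N * L) r h
              (subst (_< N * L + h) (sym (m+[n∸m]≡n NL≤n)) (subst (n <_) length-build n<|X|))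
      r≡n%L : r ≡ n % L
      r≡n%L = sym (begin
        n % L               ≡⟨ cong (_% L) (trans (sym (m+[n∸m]≡n NL≤n)) (+-comm (N * L) r)) ⟩
        (r + N * L) % L     ≡⟨ [m+kn]%n≡m%n r N L ⟩
        r % L               ≡⟨ m<n⇒m%n≡m (<-≤-trans r<h (m≤m+n h d)) ⟩
        r                   ∎)

    at-build-word : ∀ {t e} (t<N : t < N) → e < d →
      at (build d W) (t * L + h + e) ≡ at (word (W (fromℕ< t<N))) e
    at-build-word {t} {e} t<N e<d = begin
      at (build d W) (t * L + h + e)
        ≡⟨ cong₂ at build≡blocks++H (+-assoc (t * L) h e) ⟩
      at (blocks ++ H d) (t * L + (h + e))
        ≡⟨ at-++ˡ blocks (subst (_ <_) (sym length-blocks) (t*K+r<N*K t<N h+e<L)) ⟩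
      at blocks (t * L + (h + e))
        ≡⟨ at-concat-tabulate _ (λ i → length-block (W i)) t<N h+e<L ⟩
      at (H d ++ w) (h + e)
        ≡⟨ cong (λ x → at (H d ++ w) (x + e)) length-H ⟨
      at (H d ++ w) (length (H d) + e)
        ≡⟨ at-++ʳ (H d) e ⟩
      at w e
        ∎
      where
      open ≡-Reasoning
      w = word (W (fromℕ< t<N))
      h+e<L : h + e < L
      h+e<L = +-monoʳ-< h e<d

    word-in-build : ∀ {n} → n % L ≡ h → n + d ≤ length (build d W) →
      ∃ λ (t : Fin N) → ∀ {e} → e < d → at (build d W) (n + e) ≡ at (word (W t)) e
    word-in-build {n} n%L≡h n+d≤|X| =
      fromℕ< t<N , λ {e} e<d → trans (cong (λ x → at (build d W) (x + e)) n≡) (at-build-word t<N e<d)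
      where
      n≡ : n ≡ n / L * L + h
      n≡ = trans (m≡m%n+[m/n]*n n L) (trans (cong (_+ n / L * L) n%L≡h) (+-comm h _))
      t<N : n / L < N
      t<N = *-cancelʳ-< L (n / L) N (begin-strict
        n / L * L          <⟨ m<m+n (n / L * L) 1≤d ⟩
        n / L * L + d      ≤⟨ +-cancelʳ-≤ h _ _ (begin
          n / L * L + d + h    ≡⟨ +-assoc (n / L * L) d h ⟩
          n / L * L + (d + h)  ≡⟨ cong (n / L * L +_) (+-comm d h) ⟩
          n / L * L + (h + d)  ≡⟨ +-assoc (n / L * L) h d ⟨
          n / L * L + h + d    ≡⟨ cong (_+ d) n≡ ⟨
          n + d                ≤⟨ n+d≤|X| ⟩
          length (build d W)   ≡⟨ length-build ⟩
          N * L + h            ∎) ⟩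
        N * L              ∎)
        where open ≤-Reasoning

  module _ {N : ℕ} (W : Fin N → Vec Bool d) (P S R : List Σ₄) (X≡ : build d W ≡ P ++ S ++ R) where

    kind-substring : ∀ {j} → j < length S → kind (at S j) ≡ periodKind ((length P + j) % L)
    kind-substring {j} j<|S| = trans (cong kind (at-substring P S R X≡ j<|S|)) (kind-build W in-X)
      where
      in-X : length P + j < length (build d W)
      in-X = <-≤-trans (+-monoʳ-< (length P) j<|S|) (length-substring P S R X≡)

    word-in-substring : ∀ {j} → (length P + j) % L ≡ h → j + d ≤ length S →
      ∃ λ (t : Fin N) → ∀ {e} → e < d → at S (j + e) ≡ at (word (W t)) e
    word-in-substring {j} aligned j+d≤|S| with word-in-build W aligned in-X
      where
      in-X : length P + j + d ≤ length (build d W)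
      in-X = begin
        length P + j + d     ≡⟨ +-assoc (length P) j d ⟩
        length P + (j + d)   ≤⟨ +-monoʳ-≤ (length P) j+d≤|S| ⟩
        length P + length S  ≤⟨ length-substring P S R X≡ ⟩
        length (build d W)   ∎
        where open ≤-Reasoning
    ... | t , at-X≡ = t , λ {e} e<d → begin
      at S (j + e)                        ≡⟨ at-substring P S R X≡ (<-≤-trans (+-monoʳ-< j e<d) j+d≤|S|) ⟩
      at (build d W) (length P + (j + e)) ≡⟨ cong (at (build d W)) (+-assoc (length P) j e) ⟨
      at (build d W) (length P + j + e)   ≡⟨ at-X≡ e<d ⟩
      at (word (W t)) e                   ∎
      where open ≡-Reasoning

  module _ {N : ℕ} (U V : Fin N → Vec Bool d) (P₁ S₁ R₁ P₂ S₂ R₂ : List Σ₄)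
           (X≡ : build d U ≡ P₁ ++ S₁ ++ R₁) (Y≡ : build d V ≡ P₂ ++ S₂ ++ R₂)
           (|S₁|≡|S₂| : length S₁ ≡ length S₂) where

    private
      dH-window : ∀ o k → o + k ≤ length S₁ →
        ∑ k (λ i → mismatch (at S₁ (o + i)) (at S₂ (o + i))) ≤ dH S₁ S₂
      dH-window o k fits = ≤-trans (∑-window o k _ fits) (≤-reflexive (sym (dH≡∑ S₁ S₂ |S₁|≡|S₂|)))

      [m+[j+i]]%L : ∀ m j i → (m + (j + i)) % L ≡ ((m + j) % L + i) % L
      [m+[j+i]]%L m j i = trans (cong (_% L) (sym (+-assoc m j i))) (sym ([m%n+k]%n≡[m+k]%n (m + j) i L))

    misaligned⇒far : ∀ {j} → (length P₁ + j) % L ≡ 0 → (length P₂ + j) % L ≢ 0 → j + h ≤ length S₁ →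
      D ≤ dH S₁ S₂
    misaligned⇒far {j} P₁+j≡0 P₂+j≢0 fits = ≤-trans
      (shifted-period-mismatches (λ i → at S₁ (j + i)) (λ i → at S₂ (j + i)) kind₁ kind₂
                                 (n≢0⇒n>0 P₂+j≢0) (m%n<n (length P₂ + j) L))
      (dH-window j h fits)
      where
      in-S₁ : ∀ {i} → i < h → j + i < length S₁
      in-S₁ i<h = <-≤-trans (+-monoʳ-< j i<h) fits
      kind₁ : ∀ {i} → i < h → kind (at S₁ (j + i)) ≡ periodKind i
      kind₁ {i} i<h = begin
        kind (at S₁ (j + i))                         ≡⟨ kind-substring U P₁ S₁ R₁ X≡ (in-S₁ i<h) ⟩
        periodKind ((length P₁ + (j + i)) % L)       ≡⟨ cong periodKind ([m+[j+i]]%L (length P₁) j i) ⟩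
        periodKind (((length P₁ + j) % L + i) % L)   ≡⟨ cong (λ x → periodKind ((x + i) % L)) P₁+j≡0 ⟩
        periodKind (i % L)                           ≡⟨ cong periodKind (m<n⇒m%n≡m (<-≤-trans i<h (m≤m+n h d))) ⟩
        periodKind i                                 ∎
        where open ≡-Reasoning
      kind₂ : ∀ {i} → i < h → kind (at S₂ (j + i)) ≡ periodKind (((length P₂ + j) % L + i) % L)
      kind₂ {i} i<h = trans (kind-substring V P₂ S₂ R₂ Y≡ (subst (j + i <_) |S₁|≡|S₂| (in-S₁ i<h)))
                            (cong periodKind ([m+[j+i]]%L (length P₂) j i))

    aligned⇒close : ∀ {j} → (length P₁ + j) % L ≡ h → (length P₂ + j) % L ≡ h → j + d ≤ length S₁ →
      ∃₂ λ t₁ t₂ → dHv (U t₁) (V t₂) ≤ dH S₁ S₂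
    aligned⇒close {j} P₁+j≡h P₂+j≡h fits with word-in-substring U P₁ S₁ R₁ X≡ P₁+j≡h fits
                                           | word-in-substring V P₂ S₂ R₂ Y≡ P₂+j≡h (subst (j + d ≤_) |S₁|≡|S₂| fits)
    ... | t₁ , S₁≡U | t₂ , S₂≡V = t₁ , t₂ , (begin
      dHv (U t₁) (V t₂)
        ≡⟨ dHv≡∑ (U t₁) (V t₂) ⟩
      ∑ d (λ e → mismatch (at (word (U t₁)) e) (at (word (V t₂)) e))
        ≤⟨ ∑-mono d (λ e e<d → ≤-reflexive (cong₂ mismatch (sym (S₁≡U e<d)) (sym (S₂≡V e<d)))) ⟩
      ∑ d (λ e → mismatch (at S₁ (j + e)) (at S₂ (j + e)))
        ≤⟨ dH-window j d fits ⟩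
      dH S₁ S₂
        ∎)
      where open ≤-Reasoning

    private
      h<L : h < L
      h<L = m<m+n h 1≤d

    -- j₀ starts a copy of H inside S₁ and j₁ starts a word inside S₁.
    far-or-close : h + L ≤ length S₁ → D ≤ dH S₁ S₂ ⊎ ∃₂ λ t₁ t₂ → dHv (U t₁) (V t₂) ≤ dH S₁ S₂
    far-or-close long with ∃-offset-with-residue (length P₁) {0} {L} z<s
    ... | j₀ , j₀<L , P₁+j₀≡0 with (length P₂ + j₀) % L ≟ 0
    ...   | no  P₂+j₀≢0 = inj₁ (misaligned⇒far P₁+j₀≡0 P₂+j₀≢0 (begin
      j₀ + h      ≤⟨ <⇒≤ (+-monoˡ-< h j₀<L) ⟩
      L + h       ≡⟨ +-comm L h ⟩
      h + L       ≤⟨ long ⟩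
      length S₁   ∎))
      where open ≤-Reasoning
    ...   | yes P₂+j₀≡0 with ∃-offset-with-residue (length P₁) h<L
    ...     | j₁ , j₁<L , P₁+j₁≡h = inj₂ (aligned⇒close P₁+j₁≡h P₂+j₁≡h (begin
      j₁ + d      ≤⟨ <⇒≤ (+-monoˡ-< d j₁<L) ⟩
      L + d       ≡⟨ +-comm L d ⟩
      d + L       ≤⟨ +-monoˡ-≤ L (≤-trans (n≤1+n d) (m≤m*n D D)) ⟩
      h + L       ≤⟨ long ⟩
      length S₁   ∎))
      where
      open ≤-Reasoning
      P₂+j₁≡h : (length P₂ + j₁) % L ≡ h
      P₂+j₁≡h = trans (sym ([m+k]%n≡[o+k]%n⇒[m+j]%n≡[o+j]%n (length P₁) (length P₂) j₀ j₁ P₁+j₀≡P₂+j₀)) P₁+j₁≡h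
        where
        P₁+j₀≡P₂+j₀ = trans P₁+j₀≡0 (sym P₂+j₀≡0)

lemma15 : (d N : ℕ) → d ≥ 1 → N ≥ 1 →
    (U V : Fin N → Vec Bool d) →
    (ε : ℚ) → 0ℚ <ℚ ε →
    (k : ℕ) → (1ℚ +ℚ ε) *ℚ ℕ→ℚ k ≤ℚ ℕ→ℚ d →
    (S₁ S₂ : List Σ₄) →
    S₁ IsSubstringOf build d U →
    S₂ IsSubstringOf build d V →
    length S₁ ≡ length S₂ →
    length S₁ ≥ 2 * ((d + 1) * (d + 1)) + d →
    ℕ→ℚ (dH S₁ S₂) ≤ℚ (1ℚ +ℚ ε) *ℚ ℕ→ℚ k →
    ∃₂ λ (i j : Fin N) → ℕ→ℚ (dHv (U i) (V j)) ≤ℚ (1ℚ +ℚ ε) *ℚ ℕ→ℚ k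
lemma15 d N 1≤d _ U V ε _ k budget≤d S₁ S₂ (P₁ , R₁ , X≡) (P₂ , R₂ , Y≡) |S₁|≡|S₂| long dH≤budget
  with far-or-close U V P₁ S₁ R₁ P₂ S₂ R₂ X≡ Y≡ |S₁|≡|S₂| (subst (_≤ length S₁) (length-bound d) long)
  where
  open Gadget d 1≤d
  length-bound : ∀ d → 2 * ((d + 1) * (d + 1)) + d ≡ suc d * suc d + (suc d * suc d + d)
  length-bound = solve-∀
... | inj₁ D≤dH = contradiction (ℕ→ℚ-cancel-≤ (≤ℚ-trans dH≤budget budget≤d)) (<⇒≱ D≤dH)
... | inj₂ (i , j , dHv≤dH) = i , j , ≤ℚ-trans (ℕ→ℚ-mono-≤ dHv≤dH) dH≤budget
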